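{- Let $m, n$ be integers with $m, n \geq 3$. Then $F(C_n \circ C_m) \geq nm + n - m + \left\lfloor \frac{m}{2} \right\rfloor$.
   Context: All graphs are simple, finite and undirected; $C_k$ is the cycle on $k$ vertices. The corona $G \circ H$ is the graph obtained from one copy of $G$ and $|V(G)|$ disjoint copies of $H$ by joining the $i$th vertex of $G$ to every vertex of the $i$th copy of $H$. Zero forcing: each vertex is blue or white; starting from an initial set $S$ of blue vertices, repeatedly apply the color-change rule: if a blue vertex $u$ has exactly one white neighbor $v$, color $v$ blue. $S$ is a zero forcing set if eventually all vertices are blue, and a failed zero forcing set otherwise. $F(G)$ denotes the maximum cardinality of a failed zero forcing set of $G$. -}

module Defs where

open import Data.Nat using (ℕ; zero; suc; _≡ᵇ_; _∸_)
open import Data.Bool using (Bool; true; false; _∨_; _∧_)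
open import Data.Fin using (Fin; toℕ; splitAt; remQuot)
open import Data.Fin.Subset using (Subset; _∈_; _∉_; ⊤; ∣_∣; inside)
open import Data.Vec using (_[_]≔_)
open import Data.Product using (_×_; _,_; Σ; ∃)
open import Data.Sum using (inj₁; inj₂)
open import Relation.Binary.PropositionalEquality using (_≡_)
open import Relation.Binary.Construct.Closure.ReflexiveTransitive using (Star)
open import Relation.Nullary using (¬_)

-- A finite graph on vertex set Fin order, given by a (Boolean) adjacency
-- function.  All graphs built below are simple (symmetric, loopless).
record Graph : Set where
  field
    order : ℕ
    adj   : Fin order → Fin order → Bool
open Graph public

_==_ : ∀ {k} → Fin k → Fin k → Bool
i == j = toℕ i ≡ᵇ toℕ j

cycSucc : (k : ℕ) → Fin k → Fin k → Bool
cycSucc k i j = (toℕ j ≡ᵇ suc (toℕ i)) ∨ ((toℕ i ≡ᵇ (k ∸ 1)) ∧ (toℕ j ≡ᵇ 0))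

-- The cycle C_k (a genuine simple cycle when k ≥ 3)
C : ℕ → Graph
C k = record { order = k ; adj = λ i j → cycSucc k i j ∨ cycSucc k j i }

-- Corona G ∘ H.  Vertices: Fin (|G| + |G|·|H|); the first |G| are the copy of G,
-- a vertex p of the second block stands for vertex h of the i-th copy of H,
-- where (i , h) = remQuot |H| p.
corona : Graph → Graph → Graph
corona G H = record { order = NG Data.Nat.+ NG Data.Nat.* NH ; adj = a }
  where
  NG = order G
  NH = order H
  a : Fin (NG Data.Nat.+ NG Data.Nat.* NH) → Fin (NG Data.Nat.+ NG Data.Nat.* NH) → Bool
  a x y with splitAt NG x | splitAt NG y
  ... | inj₁ u | inj₁ v = adj G u v
  ... | inj₁ u | inj₂ p with remQuot {NG} NH p
  ...   | (i , _) = u == i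
  a x y | inj₂ p | inj₁ v with remQuot {NG} NH p
  ...   | (i , _) = v == i
  a x y | inj₂ p | inj₂ q with remQuot {NG} NH p | remQuot {NG} NH q
  ...   | (i , h) | (j , h') = (i == j) ∧ adj H h h'

-- Zero forcing.  A colouring is a subset (inside = blue).
-- One application of the colour-change rule: blue u has exactly one white
-- neighbour v, and v becomes blue.
data ForceStep (G : Graph) : Subset (order G) → Subset (order G) → Set where
  force : ∀ {S} (u v : Fin (order G)) →
          u ∈ S → v ∉ S → adj G u v ≡ true →
          (∀ w → adj G u w ≡ true → w ∉ S → w ≡ v) →
          ForceStep G S (S [ v ]≔ inside)

IsZeroForcingSet : (G : Graph) → Subset (order G) → Set
IsZeroForcingSet G S = Star (ForceStep G) S ⊤

IsFailedZeroForcingSet : (G : Graph) → Subset (order G) → Set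
IsFailedZeroForcingSet G S = ¬ IsZeroForcingSet G S

-- F(G) ≥ k : some failed zero forcing set has cardinality at least k
-- (equivalent to "the maximum cardinality of a failed zero forcing set is ≥ k").
F≥ : Graph → ℕ → Set
F≥ G k = Σ (Subset (order G)) λ S → IsFailedZeroForcingSet G S × k Data.Nat.≤ ∣ S ∣

-- Colour blue every vertex of C_n ∘ C_m except the even-numbered vertices of the first
-- copy of C_m. No blue vertex then has exactly one white neighbour: the base vertex of
-- that copy sees all ⌈m/2⌉ ≥ 2 white vertices, an odd vertex of the copy sees its two
-- even cycle-neighbours, and every other blue vertex sees no white vertex. So forcing
-- is stuck before the colouring is complete, with nm + n − ⌈m/2⌉ = nm + n − m + ⌊m/2⌋
-- vertices blue.
module Submission where

open import Defs
open import Data.Nat as ℕ using (ℕ; zero; suc; _≤_; _<_; _+_; _*_; _∸_; _/_; z≤n; s≤s; parity)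
open import Data.Nat.Properties using (≡⇒≡ᵇ; ≤-trans; ≤-reflexive; <-irrefl; n≤1+n; m≤n⇒m<n∨m≡n; +-assoc; +-comm; m+n∸m≡n)
open import Data.Nat.DivMod using (m/n≡1+[m∸n]/n)
open import Data.Parity.Base using (0ℙ; 1ℙ; _⁻¹)
open import Data.Parity.Properties using (suc-homo-⁻¹)
open import Data.Bool using (Bool; true; false; _∧_)
open import Data.Bool.Properties using (T-≡; ∨-zeroʳ)
open import Data.Empty using (⊥-elim)
open import Data.Fin as Fin using (Fin; toℕ; splitAt; remQuot; combine; _↑ˡ_; _↑ʳ_; fromℕ<)
open import Data.Fin.Properties using (splitAt⁻¹-↑ˡ; splitAt⁻¹-↑ʳ; splitAt-↑ˡ; splitAt-↑ʳ; remQuot-combine; combine-remQuot; combine-injectiveʳ; ↑ʳ-injective; toℕ-fromℕ<; toℕ<n)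
open import Data.Fin.Subset using (Subset; _∈_; _∉_; ⊤; ∣_∣; inside; outside)
open import Data.Fin.Subset.Properties using (∈⊤; ∣⊤∣≡n)
open import Data.Vec using (_∷_; []; _++_; lookup; here; there)
open import Data.Vec.Properties using (lookup-++ˡ; lookup-++ʳ; lookup-replicate; []=⇒lookup; lookup⇒[]=)
open import Data.Product using (_×_; _,_; proj₁; proj₂; ∃-syntax)
open import Data.Sum using (inj₁; inj₂)
open import Function using (_∘_; Equivalence)
open import Relation.Nullary using (¬_; yes; no)
open import Relation.Unary using (Pred)
open import Relation.Binary.PropositionalEquality
open import Relation.Binary.Construct.Closure.ReflexiveTransitive using (ε; _◅_)

WhiteNeighbour : (G : Graph) → Subset (order G) → Fin (order G) → Fin (order G) → Set
WhiteNeighbour G S u w = adj G u w ≡ true × w ∉ S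

Stalled : (G : Graph) → Subset (order G) → Set
Stalled G S = ∀ {u v} → u ∈ S → WhiteNeighbour G S u v →
  ∃[ w ] WhiteNeighbour G S u w × w ≢ v

stalled⇒¬ForceStep : ∀ {G S T} → Stalled G S → ¬ ForceStep G S T
stalled⇒¬ForceStep stalled (force u v u∈S v∉S uv unique)
  with stalled u∈S (uv , v∉S)
... | w , (uw , w∉S) , w≢v = w≢v (unique w uw w∉S)

stalled⇒failed : ∀ {G S x} → Stalled G S → x ∉ S → IsFailedZeroForcingSet G S
stalled⇒failed _       x∉⊤ ε          = x∉⊤ ∈⊤
stalled⇒failed stalled _   (step ◅ _)  = stalled⇒¬ForceStep stalled step

F≥-mono : ∀ {G k l} → k ≤ l → F≥ G l → F≥ G k
F≥-mono k≤l (S , failed , l≤∣S∣) = S , failed , ≤-trans k≤l l≤∣S∣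

distinct⇒∃≢ : ∀ {k p} {P : Pred (Fin k) p} {w₁ w₂} → w₁ ≢ w₂ → P w₁ → P w₂ →
  ∀ v → ∃[ w ] P w × w ≢ v
distinct⇒∃≢ {w₁ = w₁} w₁≢w₂ p₁ p₂ v with w₁ Fin.≟ v
... | yes refl = _ , p₂ , w₁≢w₂ ∘ sym
... | no w₁≢v  = _ , p₁ , w₁≢v

same-membership : ∀ {a b} {S : Subset a} {P : Subset b} {x y} →
  lookup S x ≡ lookup P y → x ∈ S → y ∈ P
same-membership S[x]≡P[y] x∈S = lookup⇒[]= _ _ (trans (sym S[x]≡P[y]) ([]=⇒lookup x∈S))

∣++∣ : ∀ {a b} (xs : Subset a) (ys : Subset b) → ∣ xs ++ ys ∣ ≡ ∣ xs ∣ + ∣ ys ∣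
∣++∣ []            ys = refl
∣++∣ (true ∷ xs)   ys = cong suc (∣++∣ xs ys)
∣++∣ (false ∷ xs)  ys = ∣++∣ xs ys

-- The base has syntactically suc n vertices, so that suc n * K unfolds to K + n * K
-- and the first copy of H can be split off.
module Corona (n : ℕ) (adjG : Fin (suc n) → Fin (suc n) → Bool) (H : Graph) where

  G : Graph
  G = record { order = suc n ; adj = adjG }

  private
    K = order H
    GH = corona G H

  base : Fin (suc n) → Fin (order GH)
  base g = g ↑ˡ (suc n * K)

  copy : Fin (suc n) → Fin K → Fin (order GH)
  copy i h = suc n ↑ʳ combine i h

  adj-base-copy : ∀ g i h → adj GH (base g) (copy i h) ≡ (g == i)
  adj-base-copy g i h
    rewrite splitAt-↑ˡ (suc n) g (suc n * K) | splitAt-↑ʳ (suc n) (suc n * K) (combine i h) =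
    cong (λ (i′ , _) → g == i′) (remQuot-combine i h)

  adj-copy-copy : ∀ i j h h′ → adj GH (copy i h) (copy j h′) ≡ ((i == j) ∧ adj H h h′)
  adj-copy-copy i j h h′
    rewrite splitAt-↑ʳ (suc n) (suc n * K) (combine i h) | splitAt-↑ʳ (suc n) (suc n * K) (combine j h′) =
    cong₂ (λ (i′ , k) (j′ , k′) → (i′ == j′) ∧ adj H k k′) (remQuot-combine i h) (remQuot-combine j h′)

  copy-injective : ∀ {i h h′} → copy i h ≡ copy i h′ → h ≡ h′
  copy-injective {i} {h} {h′} eq = combine-injectiveʳ i h i h′ (↑ʳ-injective (suc n) _ _ eq)

  data View : Fin (order GH) → Set where
    base-view : ∀ g → View (base g)
    copy-view : ∀ i h → View (copy i h)

  view : ∀ x → View x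
  view x with splitAt (suc n) x in eq
  ... | inj₁ g = subst View (splitAt⁻¹-↑ˡ eq) (base-view g)
  ... | inj₂ p = subst View (trans (cong (suc n ↑ʳ_) (combine-remQuot {suc n} K p)) (splitAt⁻¹-↑ʳ eq))
    (copy-view (proj₁ (remQuot K p)) (proj₂ (remQuot K p)))

  blueExceptFirstCopy : Subset K → Subset (order GH)
  blueExceptFirstCopy P = ⊤ {suc n} ++ (P ++ ⊤ {n * K})

  module _ (P : Subset K) where

    private
      S = blueExceptFirstCopy P

    base∈ : ∀ g → base g ∈ S
    base∈ g = lookup⇒[]= _ S (trans (lookup-++ˡ ⊤ _ g) (lookup-replicate g inside))

    copy-suc∈ : ∀ i h → copy (Fin.suc i) h ∈ S
    copy-suc∈ i h = lookup⇒[]= _ S (begin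
      lookup S (copy (Fin.suc i) h)        ≡⟨ lookup-++ʳ (⊤ {suc n}) (P ++ ⊤) (K ↑ʳ combine i h) ⟩
      lookup (P ++ ⊤) (K ↑ʳ combine i h)   ≡⟨ lookup-++ʳ P (⊤ {n * K}) (combine i h) ⟩
      lookup ⊤ (combine i h)               ≡⟨ lookup-replicate (combine i h) inside ⟩
      inside                               ∎)
      where open ≡-Reasoning

    lookup-copy-zero : ∀ h → lookup S (copy Fin.zero h) ≡ lookup P h
    lookup-copy-zero h = trans (lookup-++ʳ (⊤ {suc n}) (P ++ ⊤) (h ↑ˡ (n * K))) (lookup-++ˡ P (⊤ {n * K}) h)

    copy-zero∉ : ∀ {h} → h ∉ P → copy Fin.zero h ∉ S
    copy-zero∉ h∉P = h∉P ∘ same-membership (lookup-copy-zero _)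

    -- The only blue vertices with white neighbours are base zero, which sees every
    -- white vertex of the first copy, and the blue vertices of that copy.
    blueExceptFirstCopy-stalled : Stalled H P → ∀ {w₁ w₂} → w₁ ≢ w₂ → w₁ ∉ P → w₂ ∉ P →
      Stalled GH S
    blueExceptFirstCopy-stalled stalledH {w₁} {w₂} w₁≢w₂ w₁∉P w₂∉P {u} {v} u∈S (uv , v∉S) =
      go (view u) (view v) u∈S uv v∉S
      where
      go : ∀ {u v} → View u → View v → u ∈ S → adj GH u v ≡ true → v ∉ S →
        ∃[ w ] WhiteNeighbour GH S u w × w ≢ v
      go _ (base-view g) _ _ v∉S = ⊥-elim (v∉S (base∈ g))
      go _ (copy-view (Fin.suc j) h′) _ _ v∉S = ⊥-elim (v∉S (copy-suc∈ j h′))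
      go (base-view Fin.zero) (copy-view Fin.zero h′) _ _ _ =
        distinct⇒∃≢ (w₁≢w₂ ∘ copy-injective {Fin.zero})
          (adj-base-copy Fin.zero Fin.zero w₁ , copy-zero∉ w₁∉P)
          (adj-base-copy Fin.zero Fin.zero w₂ , copy-zero∉ w₂∉P) _
      go (base-view (Fin.suc g)) (copy-view Fin.zero h′) _ uv _
        with () ← trans (sym (adj-base-copy (Fin.suc g) Fin.zero h′)) uv
      go (copy-view (Fin.suc i) h) (copy-view Fin.zero h′) _ uv _
        with () ← trans (sym (adj-copy-copy (Fin.suc i) Fin.zero h h′)) uv
      go (copy-view Fin.zero h) (copy-view Fin.zero h′) u∈S uv v∉S
        with stalledH (same-membership (lookup-copy-zero h) u∈S)
                      (trans (sym (adj-copy-copy Fin.zero Fin.zero h h′)) uv ,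
                       v∉S ∘ same-membership (sym (lookup-copy-zero h′)))
      ... | w , (hw , w∉P) , w≢h′ =
        copy Fin.zero w , (trans (adj-copy-copy Fin.zero Fin.zero h w) hw , copy-zero∉ w∉P) ,
        w≢h′ ∘ copy-injective {Fin.zero}

    ∣blueExceptFirstCopy∣ : ∣ S ∣ ≡ suc n + (∣ P ∣ + n * K)
    ∣blueExceptFirstCopy∣ = begin
      ∣ S ∣                                  ≡⟨ ∣++∣ (⊤ {suc n}) (P ++ ⊤) ⟩
      ∣ ⊤ {suc n} ∣ + ∣ P ++ ⊤ ∣             ≡⟨ cong₂ _+_ (∣⊤∣≡n (suc n)) (∣++∣ P (⊤ {n * K})) ⟩
      suc n + (∣ P ∣ + ∣ ⊤ {n * K} ∣)        ≡⟨ cong (λ k → suc n + (∣ P ∣ + k)) (∣⊤∣≡n (n * K)) ⟩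
      suc n + (∣ P ∣ + n * K)                ∎
      where open ≡-Reasoning

  F≥-corona : (P : Subset K) → Stalled H P → ∀ {w₁ w₂} → w₁ ≢ w₂ → w₁ ∉ P → w₂ ∉ P →
    F≥ GH (suc n + (∣ P ∣ + n * K))
  F≥-corona P stalledH w₁≢w₂ w₁∉P w₂∉P =
    blueExceptFirstCopy P ,
    stalled⇒failed (blueExceptFirstCopy-stalled P stalledH w₁≢w₂ w₁∉P w₂∉P) (copy-zero∉ P w₁∉P) ,
    ≤-reflexive (sym (∣blueExceptFirstCopy∣ P))

alternating : (k : ℕ) → Subset k
alternating zero          = []
alternating (suc zero)    = outside ∷ []
alternating (suc (suc k)) = outside ∷ inside ∷ alternating k

∈-alternating⇒odd : ∀ {k} {h : Fin k} → h ∈ alternating k → parity (toℕ h) ≡ 1ℙ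
∈-alternating⇒odd {suc zero}    (there ())
∈-alternating⇒odd {suc (suc k)} (there here)       = refl
∈-alternating⇒odd {suc (suc k)} (there (there h∈)) = ∈-alternating⇒odd h∈

even⇒∉-alternating : ∀ {k} {h : Fin k} → parity (toℕ h) ≡ 0ℙ → h ∉ alternating k
even⇒∉-alternating even h∈ with () ← trans (sym even) (∈-alternating⇒odd h∈)

∣alternating∣ : ∀ k → ∣ alternating k ∣ ≡ k / 2
∣alternating∣ zero          = refl
∣alternating∣ (suc zero)    = refl
∣alternating∣ (suc (suc k)) =
  trans (cong suc (∣alternating∣ k)) (sym (m/n≡1+[m∸n]/n {suc (suc k)} {2} (s≤s (s≤s z≤n))))

≡ᵇ-refl : ∀ x → (x ℕ.≡ᵇ x) ≡ true
≡ᵇ-refl x = Equivalence.to T-≡ (≡⇒≡ᵇ x x refl)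

adj-C-succ : ∀ {m} {u w : Fin m} → toℕ w ≡ suc (toℕ u) → adj (C m) u w ≡ true
adj-C-succ {u = u} w≡1+u rewrite w≡1+u | ≡ᵇ-refl (toℕ u) = refl

adj-C-pred : ∀ {m} {u w : Fin m} → toℕ u ≡ suc (toℕ w) → adj (C m) u w ≡ true
adj-C-pred {w = w} u≡1+w rewrite u≡1+w | ≡ᵇ-refl (toℕ w) = ∨-zeroʳ _

adj-C-wrap : ∀ {m} {u w : Fin m} → toℕ u ≡ m ∸ 1 → toℕ w ≡ 0 → adj (C m) u w ≡ true
adj-C-wrap {m} u≡m-1 w≡0 rewrite u≡m-1 | w≡0 | ≡ᵇ-refl (m ∸ 1) = refl

EvenNeighbour : ∀ m → Fin m → Fin m → Set
EvenNeighbour m u w = adj (C m) u w ≡ true × parity (toℕ w) ≡ 0ℙ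

-- The even neighbours of an odd vertex u = k + 1 are k and k + 2, which wraps to 0
-- when k + 2 = m; they are distinct because m ≥ 3.
module _ {m} (3≤m : 3 ≤ m) {u : Fin m} {k} (u≡1+k : toℕ u ≡ suc k) (even-k : parity k ≡ 0ℙ) where

  private
    k<m : k < m
    k<m = ≤-trans (n≤1+n (suc k)) (subst (_< m) u≡1+k (toℕ<n u))

    fromℕ<-k-≢ : ∀ {w : Fin m} → k ≢ toℕ w → fromℕ< k<m ≢ w
    fromℕ<-k-≢ k≢w refl = k≢w (sym (toℕ-fromℕ< k<m))

  pred-even-neighbour : EvenNeighbour m u (fromℕ< k<m)
  pred-even-neighbour = adj-C-pred (trans u≡1+k (cong suc (sym (toℕ-fromℕ< k<m)))) ,
                        trans (cong parity (toℕ-fromℕ< k<m)) even-k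

  succ-even-neighbour : ∃[ w ] fromℕ< k<m ≢ w × EvenNeighbour m u w
  succ-even-neighbour with m≤n⇒m<n∨m≡n (subst (_< m) u≡1+k (toℕ<n u))
  ... | inj₁ 2+k<m =
    fromℕ< 2+k<m ,
    fromℕ<-k-≢ (λ k≡ → j≢2+j (trans k≡ (toℕ-fromℕ< 2+k<m))) ,
    adj-C-succ (trans (toℕ-fromℕ< 2+k<m) (cong suc (sym u≡1+k))) ,
    trans (cong parity (toℕ-fromℕ< 2+k<m)) even-k
    where
    j≢2+j : ∀ {j} → j ≢ suc (suc j)
    j≢2+j ()
  ... | inj₂ 2+k≡m =
    fromℕ< 0<m ,
    fromℕ<-k-≢ (λ k≡ → k≢0 (trans k≡ (toℕ-fromℕ< 0<m))) ,
    adj-C-wrap (trans u≡1+k (cong (_∸ 1) 2+k≡m)) (toℕ-fromℕ< 0<m) ,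
    cong parity (toℕ-fromℕ< 0<m)
    where
    0<m : 0 < m
    0<m = ≤-trans (s≤s z≤n) 3≤m
    k≢0 : k ≢ 0
    k≢0 refl = <-irrefl 2+k≡m 3≤m

TwoEvenNeighbours : ∀ m → Fin m → Set
TwoEvenNeighbours m u = ∃[ w₁ ] ∃[ w₂ ] w₁ ≢ w₂ × EvenNeighbour m u w₁ × EvenNeighbour m u w₂

odd⇒two-even-neighbours : ∀ {m} → 3 ≤ m → (u : Fin m) → parity (toℕ u) ≡ 1ℙ →
  TwoEvenNeighbours m u
odd⇒two-even-neighbours 3≤m u odd = from (toℕ u) refl odd
  where
  from : ∀ t → toℕ u ≡ t → parity t ≡ 1ℙ → TwoEvenNeighbours _ u
  from (suc k) u≡1+k odd-1+k with even-k ← trans (sym (suc-homo-⁻¹ k)) (cong _⁻¹ odd-1+k)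
    with w₂ , w₁≢w₂ , uw₂ ← succ-even-neighbour 3≤m u≡1+k even-k =
    _ , w₂ , w₁≢w₂ , pred-even-neighbour 3≤m u≡1+k even-k , uw₂

alternating-stalled : ∀ {m} → 3 ≤ m → Stalled (C m) (alternating m)
alternating-stalled 3≤m {u} {v} u∈ _
  with odd⇒two-even-neighbours 3≤m u (∈-alternating⇒odd u∈)
... | w₁ , w₂ , w₁≢w₂ , (uw₁ , even₁) , (uw₂ , even₂) =
  distinct⇒∃≢ w₁≢w₂ (uw₁ , even⇒∉-alternating even₁) (uw₂ , even⇒∉-alternating even₂) v

corona-bound-rearrange : ∀ n m d → ((suc n * m + suc n) ∸ m) + d ≡ suc n + (d + n * m)
corona-bound-rearrange n m d = begin
  ((m + n * m + suc n) ∸ m) + d   ≡⟨ cong (λ x → (x ∸ m) + d) (+-assoc m (n * m) (suc n)) ⟩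
  ((m + (n * m + suc n)) ∸ m) + d ≡⟨ cong (_+ d) (m+n∸m≡n m (n * m + suc n)) ⟩
  (n * m + suc n) + d             ≡⟨ cong (_+ d) (+-comm (n * m) (suc n)) ⟩
  (suc n + n * m) + d             ≡⟨ +-assoc (suc n) (n * m) d ⟩
  suc n + (n * m + d)             ≡⟨ cong (suc n +_) (+-comm (n * m) d) ⟩
  suc n + (d + n * m)             ∎
  where open ≡-Reasoning

corollary3p19 : (m n : ℕ) → 3 ≤ m → 3 ≤ n →
    F≥ (corona (C n) (C m)) (((n * m + n) ∸ m) + m / 2)
corollary3p19 m (suc n) 3≤m@(s≤s (s≤s (s≤s _))) _ =
  F≥-mono (≤-reflexive bound)
    (F≥-corona (alternating m) (alternating-stalled 3≤m) 0≢2
      (even⇒∉-alternating refl) (even⇒∉-alternating refl))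
  where
  open Corona n (adj (C (suc n))) (C m)
  0≢2 : Fin.zero ≢ Fin.suc (Fin.suc Fin.zero)
  0≢2 ()
  bound : ((suc n * m + suc n) ∸ m) + m / 2 ≡ suc n + (∣ alternating m ∣ + n * m)
  bound = trans (corona-bound-rearrange n m (m / 2)) (cong (λ d → suc n + (d + n * m)) (sym (∣alternating∣ m)))
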